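{- For any graph $G$ and any integer $\ell\geq 0$, $\operatorname{Z}^s_{(\ell)}(G)=\operatorname{Z}_{(\ell)}(G)$. In particular, a set $B\subseteq V(G)$ is an $\ell$-leaky forcing set of $G$ if and only if $B$ is a specified $\ell$-leaky forcing set of $G$.
   Context: All graphs are finite simple graphs. Given a graph $G$ and a set $B\subseteq V(G)$ of initially blue vertices (all other vertices white), the zero forcing color-change rule says: if a blue vertex $u$ has exactly one white neighbor $w$, then $u$ may force $w$ (written $u\rightarrow w$). A vertex leak is a vertex not allowed to perform any force. A set $B$ is an $\ell$-leaky forcing set if for every set of $\ell$ vertex leaks, exhaustively applying the color-change rule from $B$ (with leaks never forcing) turns all of $G$ blue; $\operatorname{Z}_{(\ell)}(G)$ is the minimum size of such a set. A specified leak $v\rightarrow u$ (for adjacent $v,u$) prohibits the single force of $v$ forcing $u$. A set $B$ is a specified $\ell$-leaky forcing set if $B$ can color all of $G$ blue whenever any set of $\ell$ forces is prohibited; $\operatorname{Z}^s_{(\ell)}(G)$ is the minimum size of a specified $\ell$-leaky forcing set. -}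

module Defs where

open import Data.Nat using (ℕ; _≤_)
open import Data.Bool using (Bool; true; false)
open import Data.Fin using (Fin)
open import Data.Fin.Subset using (Subset; _∈_; ∣_∣)
open import Data.List using (List; length)
open import Data.List.Relation.Unary.All using (All)
import Data.List.Membership.Propositional as LM
open import Data.Product using (_×_; _,_; Σ)
open import Relation.Binary.PropositionalEquality using (_≡_; _≢_)
open import Relation.Nullary using (¬_)
open import Function.Bundles using (_⇔_)

record Graph (n : ℕ) : Set where
  field
    adj   : Fin n → Fin n → Bool
    sym   : ∀ u v → adj u v ≡ adj v u
    irrefl : ∀ v → adj v v ≡ false

open Graph public

Adj : ∀ {n} → Graph n → Fin n → Fin n → Set
Adj G u v = adj G u v ≡ true

-- Final blue set obtained by exhaustively applying the colour-change rule
-- starting from B, where a force u → v is only permitted if Allowed u v.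
data Blue {n : ℕ} (G : Graph n) (Allowed : Fin n → Fin n → Set) (B : Subset n)
          : Fin n → Set where
  initial : ∀ {v} → v ∈ B → Blue G Allowed B v
  force   : ∀ {u v} → Blue G Allowed B u → Adj G u v → Allowed u v →
            (∀ w → Adj G u w → w ≢ v → Blue G Allowed B w) →
            Blue G Allowed B v

Forces : ∀ {n} → Graph n → (Fin n → Fin n → Set) → Subset n → Set
Forces G Allowed B = ∀ v → Blue G Allowed B v

VertexLeakAllowed : ∀ {n} → List (Fin n) → Fin n → Fin n → Set
VertexLeakAllowed L u v = ¬ (u LM.∈ L)

LeakyForcing : ∀ {n} → Graph n → ℕ → Subset n → Set
LeakyForcing G ℓ B =
  ∀ (L : List _) → length L ≤ ℓ → Forces G (VertexLeakAllowed L) B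

SpecLeakAllowed : ∀ {n} → List (Fin n × Fin n) → Fin n → Fin n → Set
SpecLeakAllowed L u v = ¬ ((u , v) LM.∈ L)

SpecLeakyForcing : ∀ {n} → Graph n → ℕ → Subset n → Set
SpecLeakyForcing G ℓ B =
  ∀ (L : List _) → All (λ p → Adj G (Data.Product.proj₁ p) (Data.Product.proj₂ p)) L →
  length L ≤ ℓ → Forces G (SpecLeakAllowed L) B

IsMinSize : ∀ {n} → (Subset n → Set) → ℕ → Set
IsMinSize {n} P k = Σ (Subset n) (λ B → P B × ∣ B ∣ ≡ k) × (∀ B → P B → k ≤ ∣ B ∣)

IsZℓ : ∀ {n} → Graph n → ℕ → ℕ → Set
IsZℓ G ℓ = IsMinSize (LeakyForcing G ℓ)

IsZsℓ : ∀ {n} → Graph n → ℕ → ℕ → Set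
IsZsℓ G ℓ = IsMinSize (SpecLeakyForcing G ℓ)

-- Vertex leaks at a set L can be simulated by at most |L| specified leaks. Let S be the blue set
-- reached from B when the vertices of L never force, and for each u ∈ L with a neighbour w ∉ S
-- prohibit the force u → w. Everything blue under these prohibitions lies in S: a force u → v into
-- v ∉ S has all other neighbours of u in S (inductively), so if u ∈ L then its unreached neighbour
-- w must be v, and u → v is prohibited. Conversely, prohibiting the force v → u is weaker than
-- making v leak. Choosing w requires S to be decidable, which holds because the colour-change
-- rule can be run to saturation on a finite graph.
module Submission where

open import Defs hiding (sym)
open import Data.Nat using (ℕ; zero; suc; _+_; _≤_; _<_)
open import Data.Nat.Properties using (≤-trans; <-≤-trans; <-irrefl; +-suc; +-monoʳ-≤; m≤m+n; ≤-reflexive)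
open import Data.Fin using (Fin) renaming (_≟_ to _≟ᶠ_)
open import Data.Fin.Subset using (Subset; _∈_; _∉_; ∣_∣; _∪_; ⁅_⁆; _⊆_)
open import Data.Fin.Subset.Properties using (_∈?_; x∈⁅x⁆; x∈⁅y⁆⇒x≡y; p⊆p∪q; x∈p∪q⁻; x∈p∪q⁺; p⊂q⇒∣p∣<∣q∣; ∣p∣≤n)
open import Data.Fin.Properties using (any?; all?)
open import Data.Bool using (true) renaming (_≟_ to _≟ᵇ_)
open import Data.Maybe using (Maybe; just; nothing)
import Data.Maybe.Relation.Unary.All as MaybeAll
import Data.Maybe.Relation.Unary.Any as MaybeAny
open import Data.List using (List; map; mapMaybe)
open import Data.List.Properties using (length-map; length-mapMaybe)
open import Data.List.Relation.Unary.All using (All; universal)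
import Data.List.Relation.Unary.All.Properties as All
import Data.List.Relation.Unary.Any as Any
import Data.List.Relation.Unary.Any.Properties as Any
import Data.List.Membership.Propositional as LM
open import Data.List.Membership.Propositional.Properties using (∈-map⁺)
open import Data.Product using (_×_; _,_; ∃; ∃₂; proj₁; proj₂)
open import Data.Sum using (inj₁; inj₂)
open import Relation.Binary.PropositionalEquality using (_≡_; _≢_; refl; sym; subst)
open import Relation.Nullary using (¬_; Dec; yes; no; contradiction)
open import Relation.Nullary.Decidable using (_×-dec_; _→-dec_; ¬?; map′)
open import Function.Bundles using (_⇔_; mk⇔; Equivalence)
open import Function.Properties.Equivalence using () renaming (sym to ⇔-sym)

∈-mapMaybe⁺ : ∀ {A B : Set} (f : A → Maybe B) {x xs y} →
              x LM.∈ xs → f x ≡ just y → y LM.∈ mapMaybe f xs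
∈-mapMaybe⁺ f {xs = xs} x∈xs fx≡y = Any.mapMaybe⁺ f xs (Any.map⁺ (Any.map hit x∈xs))
  where
  hit : ∀ {x} → _ ≡ x → MaybeAny.Any (_ ≡_) (f x)
  hit refl = subst (MaybeAny.Any (_ ≡_)) (sym fx≡y) (MaybeAny.just refl)

IsMinSize-cong : ∀ {n} {P Q : Subset n → Set} → (∀ B → P B ⇔ Q B) →
                 ∀ k → IsMinSize P k ⇔ IsMinSize Q k
IsMinSize-cong P⇔Q k = mk⇔ (transport P⇔Q) (transport (λ B → ⇔-sym (P⇔Q B)))
  where
  transport : ∀ {P Q : Subset _ → Set} → (∀ B → P B ⇔ Q B) → IsMinSize P k → IsMinSize Q k
  transport P⇔Q ((B , PB , ∣B∣≡k) , minimal) =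
    (B , Equivalence.to (P⇔Q B) PB , ∣B∣≡k) , λ B′ QB′ → minimal B′ (Equivalence.from (P⇔Q B′) QB′)

module _ {n : ℕ} (G : Graph n) where

  open import Data.List.Membership.DecPropositional (_≟ᶠ_ {n}) using () renaming (_∈?_ to _∈ᴸ?_)

  Adj? : ∀ u v → Dec (Adj G u v)
  Adj? u v = adj G u v ≟ᵇ true

  Blue-mono-allowed : ∀ {A A′ : Fin n → Fin n → Set} {B} → (∀ u v → A u v → A′ u v) →
                      ∀ {x} → Blue G A B x → Blue G A′ B x
  Blue-mono-allowed A⊆A′ (initial x∈B) = initial x∈B
  Blue-mono-allowed A⊆A′ (force {u} {v} u-blue u~v allowed others) =
    force (Blue-mono-allowed A⊆A′ u-blue) u~v (A⊆A′ u v allowed)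
          (λ w u~w w≢v → Blue-mono-allowed A⊆A′ (others w u~w w≢v))

  Blue-bind : ∀ {A B B′} → (∀ v → v ∈ B′ → Blue G A B v) → ∀ {x} → Blue G A B′ x → Blue G A B x
  Blue-bind B′-blue (initial {v} v∈B′) = B′-blue v v∈B′
  Blue-bind B′-blue (force u-blue u~v allowed others) =
    force (Blue-bind B′-blue u-blue) u~v allowed (λ w u~w w≢v → Blue-bind B′-blue (others w u~w w≢v))

  Blue-mono-initial : ∀ {A B B′} → B ⊆ B′ → ∀ {x} → Blue G A B x → Blue G A B′ x
  Blue-mono-initial B⊆B′ = Blue-bind (λ v v∈B → initial (B⊆B′ v∈B))

  module Saturation (A : Fin n → Fin n → Set) (A? : ∀ u v → Dec (A u v)) where

    ForceAvailable : Subset n → Fin n → Fin n → Set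
    ForceAvailable B u v = u ∈ B × Adj G u v × A u v × v ∉ B × (∀ w → Adj G u w → w ≢ v → w ∈ B)

    forceAvailable? : ∀ B → Dec (∃₂ (ForceAvailable B))
    forceAvailable? B = any? λ u → any? λ v →
      (u ∈? B) ×-dec Adj? u v ×-dec A? u v ×-dec ¬? (v ∈? B) ×-dec
      all? (λ w → Adj? u w →-dec ¬? (w ≟ᶠ v) →-dec (w ∈? B))

    Blue⇒∈-stalled : ∀ {B} → ¬ ∃₂ (ForceAvailable B) → ∀ {x} → Blue G A B x → x ∈ B
    Blue⇒∈-stalled stalled (initial x∈B) = x∈B
    Blue⇒∈-stalled {B} stalled (force {u} {v} u-blue u~v allowed others) with v ∈? B
    ... | yes v∈B = v∈B
    ... | no v∉B  = contradiction
      (u , v , Blue⇒∈-stalled stalled u-blue , u~v , allowed , v∉B ,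
       λ w u~w w≢v → Blue⇒∈-stalled stalled (others w u~w w≢v))
      stalled

    ∣B∣<∣B∪⁅v⁆∣ : ∀ {B u v} → ForceAvailable B u v → ∣ B ∣ < ∣ B ∪ ⁅ v ⁆ ∣
    ∣B∣<∣B∪⁅v⁆∣ {v = v} (_ , _ , _ , v∉B , _) =
      p⊂q⇒∣p∣<∣q∣ (p⊆p∪q ⁅ v ⁆ , v , x∈p∪q⁺ (inj₂ (x∈⁅x⁆ v)) , v∉B)

    Blue-perform : ∀ {B u v} → ForceAvailable B u v → ∀ {x} → Blue G A (B ∪ ⁅ v ⁆) x → Blue G A B x
    Blue-perform {B} {v = v} (u∈B , u~v , allowed , _ , others) = Blue-bind B∪⁅v⁆-blue
      where
      B∪⁅v⁆-blue : ∀ w → w ∈ B ∪ ⁅ v ⁆ → Blue G A B w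
      B∪⁅v⁆-blue w w∈ with x∈p∪q⁻ B ⁅ v ⁆ w∈
      ... | inj₁ w∈B = initial w∈B
      ... | inj₂ w∈⁅v⁆ rewrite x∈⁅y⁆⇒x≡y v w∈⁅v⁆ =
        force (initial u∈B) u~v allowed (λ w′ u~w′ w′≢v → initial (others w′ u~w′ w′≢v))

    -- Each available force enlarges the initial set, so k + ∣ B ∣ ≥ n bounds the number of rounds.
    Blue?-bounded : ∀ k B → n ≤ k + ∣ B ∣ → ∀ x → Dec (Blue G A B x)
    Blue?-bounded k B n≤k+∣B∣ x with forceAvailable? B | k
    ... | no stalled | _ = map′ initial (Blue⇒∈-stalled stalled) (x ∈? B)
    ... | yes (_ , v , available) | zero =
      contradiction (<-≤-trans (≤-trans (∣B∣<∣B∪⁅v⁆∣ available) (∣p∣≤n (B ∪ ⁅ v ⁆))) n≤k+∣B∣) (<-irrefl refl)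
    ... | yes (_ , v , available) | suc k′ =
      map′ (Blue-perform available) (Blue-mono-initial (p⊆p∪q ⁅ v ⁆))
           (Blue?-bounded k′ (B ∪ ⁅ v ⁆) n≤k′+∣B∪⁅v⁆∣ x)
      where
      n≤k′+∣B∪⁅v⁆∣ : n ≤ k′ + ∣ B ∪ ⁅ v ⁆ ∣
      n≤k′+∣B∪⁅v⁆∣ = ≤-trans n≤k+∣B∣ (≤-trans (≤-reflexive (sym (+-suc k′ ∣ B ∣)))
                                              (+-monoʳ-≤ k′ (∣B∣<∣B∪⁅v⁆∣ available)))

    Blue? : ∀ B x → Dec (Blue G A B x)
    Blue? B = Blue?-bounded n B (m≤m+n n ∣ B ∣)

  leaky⇒specLeaky : ∀ ℓ B → LeakyForcing G ℓ B → SpecLeakyForcing G ℓ B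
  leaky⇒specLeaky ℓ B leaky L _ ∣L∣≤ℓ x =
    Blue-mono-allowed (λ u v u∉sources uv∈L → u∉sources (∈-map⁺ proj₁ uv∈L))
      (leaky (map proj₁ L) (subst (_≤ ℓ) (sym (length-map proj₁ L)) ∣L∣≤ℓ) x)

  module VertexLeaksAsSpecified (B : Subset n) (L : List (Fin n)) where

    Reached : Fin n → Set
    Reached = Blue G (VertexLeakAllowed L) B

    reached? : ∀ x → Dec (Reached x)
    reached? = Saturation.Blue? (VertexLeakAllowed L) (λ u _ → ¬? (u ∈ᴸ? L)) B

    UnreachedNeighbour : Fin n → Fin n → Set
    UnreachedNeighbour u w = Adj G u w × ¬ Reached w

    prohibition : Fin n → Maybe (Fin n × Fin n)
    prohibition u with any? (λ w → Adj? u w ×-dec ¬? (reached? w))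
    ... | yes (w , _) = just (u , w)
    ... | no _        = nothing

    prohibited : List (Fin n × Fin n)
    prohibited = mapMaybe prohibition L

    prohibition-adjacent : ∀ u → MaybeAll.All (λ p → Adj G (proj₁ p) (proj₂ p)) (prohibition u)
    prohibition-adjacent u with any? (λ w → Adj? u w ×-dec ¬? (reached? w))
    ... | yes (_ , u~w , _) = MaybeAll.just u~w
    ... | no _              = MaybeAll.nothing

    prohibited-adjacent : All (λ p → Adj G (proj₁ p) (proj₂ p)) prohibited
    prohibited-adjacent = All.mapMaybe⁺ (All.map⁺ (universal prohibition-adjacent L))

    prohibition-unreached : ∀ {u x} → UnreachedNeighbour u x →
                            ∃ λ w → UnreachedNeighbour u w × prohibition u ≡ just (u , w)
    prohibition-unreached {u} unreached-x with any? (λ w → Adj? u w ×-dec ¬? (reached? w))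
    ... | yes (w , unreached-w) = w , unreached-w , refl
    ... | no none               = contradiction (_ , unreached-x) none

    Blue-prohibited⇒Reached : ∀ {x} → Blue G (SpecLeakAllowed prohibited) B x → Reached x
    Blue-prohibited⇒Reached (initial x∈B) = initial x∈B
    Blue-prohibited⇒Reached {x} (force {u} u-blue u~x allowed others) with reached? x
    ... | yes reached = reached
    ... | no unreached with u ∈ᴸ? L
    ...   | no u∉L = contradiction
      (force (Blue-prohibited⇒Reached u-blue) u~x u∉L (λ w u~w w≢x → Blue-prohibited⇒Reached (others w u~w w≢x)))
      unreached
    ...   | yes u∈L with prohibition-unreached (u~x , unreached)
    ...     | w , (u~w , unreached-w) , prohibits with w ≟ᶠ x
    ...       | yes refl = contradiction (∈-mapMaybe⁺ prohibition u∈L prohibits) allowed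
    ...       | no w≢x   = contradiction (Blue-prohibited⇒Reached (others w u~w w≢x)) unreached-w

  specLeaky⇒leaky : ∀ ℓ B → SpecLeakyForcing G ℓ B → LeakyForcing G ℓ B
  specLeaky⇒leaky ℓ B specLeaky L ∣L∣≤ℓ x =
    Blue-prohibited⇒Reached (specLeaky prohibited prohibited-adjacent
                               (≤-trans (length-mapMaybe prohibition L) ∣L∣≤ℓ) x)
    where open VertexLeaksAsSpecified B L

corollary3p2 : ∀ (n : ℕ) (G : Graph n) (ℓ : ℕ) →
    (∀ (k : ℕ) → IsZsℓ G ℓ k ⇔ IsZℓ G ℓ k) ×
    (∀ (B : Subset n) → LeakyForcing G ℓ B ⇔ SpecLeakyForcing G ℓ B)
corollary3p2 n G ℓ = IsMinSize-cong specLeaky⇔leaky , λ B → ⇔-sym (specLeaky⇔leaky B)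
  where
  specLeaky⇔leaky : ∀ B → SpecLeakyForcing G ℓ B ⇔ LeakyForcing G ℓ B
  specLeaky⇔leaky B = mk⇔ (specLeaky⇒leaky G ℓ B) (leaky⇒specLeaky G ℓ B)
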